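{- Let $G$ and $H$ be finite, simple, connected graphs. Let $\Omega$ be a minimum strong geodetic set of $G\,\square\, H$, and let $\widetilde{I}(\Omega)$ be a corresponding family of selected geodesics (one fixed shortest path for each pair of distinct vertices of $\Omega$) whose union covers all vertices of $G\,\square\, H$. If $|V(H)| > {\rm diam}(G)\binom{|\Omega|}{2} + |\Omega|$, then there exists a vertex $h\in V(H)$ such that the $G$-layer $G^{h}$ satisfies (i) $E(G^{h}) \cap \left( \bigcup_{P\in \widetilde{I}(\Omega)} E(P)\right) = \emptyset$, and (ii) $V(G^{h})\cap \Omega = \emptyset$.
   Context: For a graph $G=(V,E)$ and $S\subseteq V$, for each pair $\{x,y\}\subseteq S$ with $x\neq y$ let $\widetilde{P}(x,y)$ be a selected fixed shortest $x,y$-path (geodesic), and let $\widetilde{I}(S)=\{\widetilde{P}(x,y): x,y\in S\}$ (so it consists of $\binom{|S|}{2}$ paths). $S$ is a strong geodetic set if for some such choice of geodesics, every vertex of $G$ lies on some path of $\widetilde{I}(S)$. A minimum strong geodetic set is one of smallest cardinality; this cardinality is the strong geodetic number ${\rm sg}(G)$. The Cartesian product $G\,\square\, H$ has vertex set $V(G)\times V(H)$, with $(g,h)$ adjacent to $(g',h')$ iff either $g=g'$ and $hh'\in E(H)$, or $h=h'$ and $gg'\in E(G)$. For $h\in V(H)$, the $G$-layer $G^h$ is the subgraph induced by $\{(x,h): x\in V(G)\}$. ${\rm diam}(G)$ is the maximum distance between vertices of $G$. -}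

module Defs where

open import Data.Nat using (ℕ; zero; suc; _+_; _*_; _≤_; _<_)
open import Data.Nat.Combinatorics using (_C_)
open import Data.Fin using (Fin) renaming (_<_ to _<ᶠ_)
open import Data.Bool using (Bool; true; false; T)
open import Data.Product using (Σ; ∃; ∃-syntax; _×_; _,_; proj₁; proj₂)
open import Data.Sum using (_⊎_)
open import Function.Definitions using (Injective)
open import Relation.Binary.PropositionalEquality using (_≡_; _≢_)
open import Relation.Nullary using (¬_)

record Graph : Set where
  field
    n      : ℕ
    adj    : Fin n → Fin n → Bool
    sym    : ∀ x y → adj x y ≡ adj y x
    irrefl : ∀ x → adj x x ≡ false

  V : Set
  V = Fin n

  Adj : V → V → Set
  Adj x y = T (adj x y)

module _ {A : Set} (Adj : A → A → Set) where

  data Walk : A → A → ℕ → Set where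
    []  : ∀ {x} → Walk x x 0
    _∷_ : ∀ {x y z m} → Adj x y → Walk y z m → Walk x z (suc m)

  data OnWalk (v : A) : ∀ {x y m} → Walk x y m → Set where
    here  : ∀ {y m} {w : Walk v y m} → OnWalk v w
    there : ∀ {x y z m} {e : Adj x y} {w : Walk y z m} →
            OnWalk v w → OnWalk v (e ∷ w)

  data EdgeOn (u u' : A) : ∀ {x y m} → Walk x y m → Set where
    here  : ∀ {x y z m} {e : Adj x y} {w : Walk y z m} →
            (x ≡ u × y ≡ u') ⊎ (x ≡ u' × y ≡ u) → EdgeOn u u' (e ∷ w)
    there : ∀ {x y z m} {e : Adj x y} {w : Walk y z m} →
            EdgeOn u u' w → EdgeOn u u' (e ∷ w)

  -- a geodesic (shortest path) from x to y: a walk no longer than any walk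
  -- from x to y (such a walk is automatically a path)
  record Geodesic (x y : A) : Set where
    field
      len      : ℕ
      walk     : Walk x y len
      shortest : ∀ m → Walk x y m → len ≤ m

  Connected : Set
  Connected = ∀ x y → ∃[ m ] Walk x y m

  IsDiameter : ℕ → Set
  IsDiameter D = (∀ x y → ∃[ m ] (Walk x y m × m ≤ D))
               × (∃[ x ] ∃[ y ] (∀ m → Walk x y m → D ≤ m))

  -- A vertex set S of size k, given as an injective map Fin k → A.
  -- A selected family of geodesics Ĩ(S): one geodesic for each pair i < j.
  GeodesicFamily : ∀ {k} → (Fin k → A) → Set
  GeodesicFamily {k} S = ∀ (i j : Fin k) → i <ᶠ j → Geodesic (S i) (S j)

  Covers : ∀ {k} {S : Fin k → A} → GeodesicFamily S → Set
  Covers {k} P = ∀ v → ∃[ i ] ∃[ j ] Σ (i <ᶠ j) λ i<j →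
                   OnWalk v (Geodesic.walk (P i j i<j))

  IsStrongGeodetic : ∀ {k} → (Fin k → A) → Set
  IsStrongGeodetic S = Σ (GeodesicFamily S) Covers

  IsMinStrongGeodetic : ∀ {k} → (Fin k → A) → Set
  IsMinStrongGeodetic {k} S =
    Injective _≡_ _≡_ S × IsStrongGeodetic S ×
    (∀ k' (S' : Fin k' → A) → Injective _≡_ _≡_ S' → IsStrongGeodetic S' → k ≤ k')

module _ (G H : Graph) where
  private
    module G = Graph G
    module H = Graph H

  □Adj : G.V × H.V → G.V × H.V → Set
  □Adj (g , h) (g' , h') = (g ≡ g' × H.Adj h h') ⊎ (h ≡ h' × G.Adj g g')

module Submission where

open import Defs
open import Data.Nat using (ℕ; zero; suc; _+_; _*_; _≤_; _<_; z≤n; s≤s)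
open import Data.Nat.Properties
open import Data.Nat.Combinatorics using (_C_; nC1≡n; nCk+nC[k+1]≡[n+1]C[k+1])
open import Data.Fin using (Fin) renaming (_<_ to _<ᶠ_)
import Data.Fin as Fin
open import Data.Fin.Properties using (¬∀⟶∃¬; <⇒notInjective)
open import Data.Product using (∃-syntax; _×_; _,_; proj₂)
open import Data.Sum using (inj₁; inj₂)
open import Data.Bool using (T)
open import Data.Empty using (⊥-elim)
open import Data.List using (List; []; _∷_; _++_; length; concat; tabulate; lookup)
open import Data.List.Properties using (length-++; length-tabulate)
open import Data.List.Relation.Unary.Any using (here; there; index)
open import Data.List.Relation.Unary.Any.Properties using (lookup-index)
open import Data.List.Membership.Propositional using (_∈_; _∉_)
open import Data.List.Membership.Propositional.Properties
  using (∈-++⁺ˡ; ∈-++⁺ʳ; ∈-concat⁺′; ∈-tabulate⁺)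
import Data.List.Membership.DecPropositional as DecMembership
open import Relation.Binary.PropositionalEquality
  using (_≡_; _≢_; refl; sym; trans; cong; subst)
open import Relation.Nullary using (¬_)

-- A geodesic of G □ H between (g, h) and (g', h') can be replaced by a
-- shortest g,g'-walk in one G-layer followed by an H-walk, so it uses at most
-- diam(G) edges lying in G-layers; hence all geodesics of Ĩ(Ω) together meet
-- the edge sets of at most diam(G)·C(|Ω|,2) layers, and Ω meets at most |Ω|
-- more.  If |V(H)| exceeds this count, some layer is avoided by both.

-- Otherwise the position of x in xs would inject Fin n into Fin (length xs).
length<⇒∃∉ : ∀ {n} (xs : List (Fin n)) → length xs < n → ∃[ x ] x ∉ xs
length<⇒∃∉ {n} xs |xs|<n =
  ¬∀⟶∃¬ n (_∈ xs) (λ x → DecMembership._∈?_ Fin._≟_ x xs) λ ∈xs →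
  <⇒notInjective {f = λ x → index (∈xs x)} |xs|<n λ {x} {y} eq →
    trans (lookup-index (∈xs x)) (trans (cong (lookup xs) eq) (sym (lookup-index (∈xs y))))

length-concat-tabulate≤ : ∀ {A : Set} {k D} (g : Fin k → List A) →
  (∀ j → length (g j) ≤ D) → length (concat (tabulate g)) ≤ k * D
length-concat-tabulate≤ {k = zero}  g bound = z≤n
length-concat-tabulate≤ {k = suc k} g bound =
  subst (_≤ suc k * _) (sym (length-++ (g Fin.zero)))
    (+-mono-≤ (bound Fin.zero)
              (length-concat-tabulate≤ (λ j → g (Fin.suc j)) (λ j → bound (Fin.suc j))))

concatPairs : ∀ {A : Set} k → ((i j : Fin k) → i <ᶠ j → List A) → List A
concatPairs zero    f = []
concatPairs (suc k) f =
  concat (tabulate (λ j → f Fin.zero (Fin.suc j) (s≤s z≤n))) ++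
  concatPairs k (λ i j i<j → f (Fin.suc i) (Fin.suc j) (s≤s i<j))

[1+k]C2≡k+kC2 : ∀ k → suc k C 2 ≡ k + k C 2
[1+k]C2≡k+kC2 k = trans (sym (nCk+nC[k+1]≡[n+1]C[k+1] k 1)) (cong (_+ k C 2) (nC1≡n k))

length-concatPairs≤ : ∀ {A : Set} k {D} (f : (i j : Fin k) → i <ᶠ j → List A) →
  (∀ i j i<j → length (f i j i<j) ≤ D) → length (concatPairs k f) ≤ D * (k C 2)
length-concatPairs≤ zero    f bound = z≤n
length-concatPairs≤ (suc k) {D} f bound = begin
  length (row ++ rest)            ≡⟨ length-++ row ⟩
  length row + length rest        ≤⟨ +-mono-≤ row≤ rest≤ ⟩
  k * D + D * (k C 2)             ≡⟨ cong (_+ D * (k C 2)) (*-comm k D) ⟩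
  D * k + D * (k C 2)             ≡⟨ *-distribˡ-+ D k (k C 2) ⟨
  D * (k + k C 2)                 ≡⟨ cong (D *_) ([1+k]C2≡k+kC2 k) ⟨
  D * (suc k C 2)                 ∎
  where
  open ≤-Reasoning
  row  = concat (tabulate (λ j → f Fin.zero (Fin.suc j) (s≤s z≤n)))
  rest = concatPairs k (λ i j i<j → f (Fin.suc i) (Fin.suc j) (s≤s i<j))
  row≤ : length row ≤ k * D
  row≤ = length-concat-tabulate≤ _ (λ j → bound Fin.zero (Fin.suc j) (s≤s z≤n))
  rest≤ : length rest ≤ D * (k C 2)
  rest≤ = length-concatPairs≤ k _ (λ i j i<j → bound (Fin.suc i) (Fin.suc j) (s≤s i<j))

∈-concatPairs⁺ : ∀ {A : Set} k (f : (i j : Fin k) → i <ᶠ j → List A) i j i<j {x} →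
  x ∈ f i j i<j → x ∈ concatPairs k f
∈-concatPairs⁺ (suc k) f Fin.zero (Fin.suc j) (s≤s z≤n) x∈ =
  ∈-++⁺ˡ (∈-concat⁺′ x∈ (∈-tabulate⁺ j))
∈-concatPairs⁺ (suc k) f (Fin.suc i) (Fin.suc j) (s≤s i<j) x∈ =
  ∈-++⁺ʳ _ (∈-concatPairs⁺ k (λ i j i<j → f (Fin.suc i) (Fin.suc j) (s≤s i<j)) i j i<j x∈)

module _ (G H : Graph) where
  private
    module G = Graph G
    module H = Graph H

  Walk□ : G.V × H.V → G.V × H.V → ℕ → Set
  Walk□ = Walk (□Adj G H)

  _++ʷ_ : ∀ {x y z m m'} → Walk□ x y m → Walk□ y z m' → Walk□ x z (m + m')
  []      ++ʷ v = v
  (e ∷ w) ++ʷ v = e ∷ (w ++ʷ v)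

  G-layerWalk : ∀ {g g' m} h → Walk G.Adj g g' m → Walk□ (g , h) (g' , h) m
  G-layerWalk h []      = []
  G-layerWalk h (a ∷ w) = inj₂ (refl , a) ∷ G-layerWalk h w

  H-layerWalk : ∀ {h h' m} g → Walk H.Adj h h' m → Walk□ (g , h) (g , h') m
  H-layerWalk g []      = []
  H-layerWalk g (a ∷ w) = inj₁ (refl , a) ∷ H-layerWalk g w

  G-edgeLayers : ∀ {x y m} → Walk□ x y m → List H.V
  G-edgeLayers []                               = []
  G-edgeLayers (_∷_ {_ , _} {_ , _} (inj₁ _) w) = G-edgeLayers w
  G-edgeLayers (_∷_ {_ , h} {_ , _} (inj₂ _) w) = h ∷ G-edgeLayers w

  projectH : ∀ {x y m} (w : Walk□ x y m) →
    ∃[ b ] (Walk H.Adj (proj₂ x) (proj₂ y) b × length (G-edgeLayers w) + b ≡ m)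
  projectH [] = 0 , [] , refl
  projectH (_∷_ {_ , _} {_ , _} (inj₁ (refl , a)) w) with projectH w
  ... | b , v , eq = suc b , a ∷ v , trans (+-suc (length (G-edgeLayers w)) b) (cong suc eq)
  projectH (_∷_ {_ , _} {_ , _} (inj₂ (refl , a)) w) with projectH w
  ... | b , v , eq = b , v , cong suc eq

  -- An edge (u, h)(u', h) cannot be an H-edge, since H has no loops.
  EdgeOn⇒∈G-edgeLayers : ∀ {x y m} (w : Walk□ x y m) {u u' h} →
    EdgeOn (□Adj G H) (u , h) (u' , h) w → h ∈ G-edgeLayers w
  EdgeOn⇒∈G-edgeLayers (_∷_ {_ , _} {_ , _} (inj₁ (_ , a)) w) {h = h} (here (inj₁ (refl , refl))) =
    ⊥-elim (subst T (H.irrefl h) a)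
  EdgeOn⇒∈G-edgeLayers (_∷_ {_ , _} {_ , _} (inj₁ (_ , a)) w) {h = h} (here (inj₂ (refl , refl))) =
    ⊥-elim (subst T (H.irrefl h) a)
  EdgeOn⇒∈G-edgeLayers (_∷_ {_ , _} {_ , _} (inj₂ _) w) (here (inj₁ (refl , refl))) = here refl
  EdgeOn⇒∈G-edgeLayers (_∷_ {_ , _} {_ , _} (inj₂ _) w) (here (inj₂ (refl , refl))) = here refl
  EdgeOn⇒∈G-edgeLayers (_∷_ {_ , _} {_ , _} (inj₁ _) w) (there p) = EdgeOn⇒∈G-edgeLayers w p
  EdgeOn⇒∈G-edgeLayers (_∷_ {_ , _} {_ , _} (inj₂ _) w) (there p) = there (EdgeOn⇒∈G-edgeLayers w p)

  length-G-edgeLayers≤ : ∀ {D} → (∀ g g' → ∃[ m ] (Walk G.Adj g g' m × m ≤ D)) →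
    ∀ {x y} (P : Geodesic (□Adj G H) x y) → length (G-edgeLayers (Geodesic.walk P)) ≤ D
  length-G-edgeLayers≤ {D} distG≤D {g , h} {g' , h'} P
    with projectH (Geodesic.walk P) | distG≤D g g'
  ... | b , v , |P|≡ | a , u , a≤D = ≤-trans (+-cancelʳ-≤ b _ a c+b≤a+b) a≤D
    where
    c+b≤a+b : length (G-edgeLayers (Geodesic.walk P)) + b ≤ a + b
    c+b≤a+b = subst (_≤ a + b) (sym |P|≡)
      (Geodesic.shortest P (a + b) (G-layerWalk h u ++ʷ H-layerWalk g' v))

lemma2p3 : (G H : Graph) → Connected (Graph.Adj G) → Connected (Graph.Adj H) →
    (D : ℕ) → IsDiameter (Graph.Adj G) D →
    (k : ℕ) (Ω : Fin k → Graph.V G × Graph.V H) →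
    IsMinStrongGeodetic (□Adj G H) Ω →
    (P : GeodesicFamily (□Adj G H) Ω) → Covers (□Adj G H) P →
    D * (k C 2) + k < Graph.n H →
    ∃[ h ]
      ((∀ (i j : Fin k) (i<j : i <ᶠ j) (u u' : Graph.V G) →
          ¬ EdgeOn (□Adj G H) (u , h) (u' , h) (Geodesic.walk (P i j i<j)))
      × (∀ (i : Fin k) → proj₂ (Ω i) ≢ h))
lemma2p3 G H _ _ D (distG≤D , _) k Ω _ P _ bound =
  let h , h∉ = length<⇒∃∉ (pathLayers ++ ΩLayers) |layers|<n in
  h , (λ i j i<j u u' e → h∉ (∈-++⁺ˡ (∈-concatPairs⁺ k _ i j i<j (EdgeOn⇒∈G-edgeLayers G H _ e))))
    , (λ i Ωi≡h → h∉ (∈-++⁺ʳ pathLayers (subst (_∈ ΩLayers) Ωi≡h (∈-tabulate⁺ i))))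
  where
  pathLayers ΩLayers : List (Graph.V H)
  pathLayers = concatPairs k (λ i j i<j → G-edgeLayers G H (Geodesic.walk (P i j i<j)))
  ΩLayers    = tabulate (λ i → proj₂ (Ω i))
  |layers|<n : length (pathLayers ++ ΩLayers) < Graph.n H
  |layers|<n = subst (_< Graph.n H)
    (sym (trans (length-++ pathLayers) (cong (length pathLayers +_) (length-tabulate _))))
    (≤-<-trans (+-monoˡ-≤ k (length-concatPairs≤ k _ λ i j i<j →
                  length-G-edgeLayers≤ G H distG≤D (P i j i<j))) bound)
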